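{- Let $\mathcal{G}$ and $\mathcal{H}$ be two hypergraphs satisfying the intersection property, and let $\sigma$ be a non-covering assignment. If $v$ is a free vertex of $\sigma$, then $$|\mathrm{Sep}(\sigma+\langle\{v\},\emptyset\rangle)|=(1-\varepsilon_v^{\mathrm{Sep}(\sigma)})\cdot|\mathrm{Sep}(\sigma)|,\qquad |\mathrm{Com}(\sigma+\langle\emptyset,\{v\}\rangle)|=(1-\varepsilon_v^{\mathrm{Com}(\sigma)})\cdot|\mathrm{Com}(\sigma)|.$$ Moreover, if $G\in\mathrm{Sep}(\sigma)$, $H\in\mathrm{Com}(\sigma)$, and $v\in G$, $w\in H$ are free vertices of $\sigma$, then $$|\mathrm{Com}(\sigma+\langle\{v\},G\setminus\{v\}\rangle)|\le\varepsilon_v^{\mathrm{Com}(\sigma)}\cdot|\mathrm{Com}(\sigma)|,\qquad |\mathrm{Sep}(\sigma+\langle H\setminus\{w\},\{w\}\rangle)|\le\varepsilon_w^{\mathrm{Sep}(\sigma)}\cdot|\mathrm{Sep}(\sigma)|.$$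
   Context: Hypergraphs are identified with their edge sets over the common vertex set $V$. Intersection property: $G\cap H\ne\emptyset$ for all $G\in\mathcal{G},H\in\mathcal{H}$. An assignment is a pair $\sigma=\langle\mathrm{In},\mathrm{Ex}\rangle$ of disjoint subsets of $V$; $v$ is free if $v\notin\mathrm{In}\cup\mathrm{Ex}$; $\sigma+\langle A,B\rangle=\langle\mathrm{In}\cup A,\mathrm{Ex}\cup B\rangle$. $\sigma$ is covering if some $H\in\mathcal{H}$ satisfies $H\subseteq\mathrm{In}$ or some $G\in\mathcal{G}$ satisfies $G\subseteq\mathrm{Ex}$. $\mathrm{Sep}(\sigma)=\{G\in\mathcal{G}:G\cap\mathrm{In}=\emptyset\}$, $\mathrm{Com}(\sigma)=\{H\in\mathcal{H}:H\cap\mathrm{Ex}=\emptyset\}$. For a set $\mathcal{S}$ of edges and a vertex $v$, $\varepsilon_v^{\mathcal{S}}=|\{S\in\mathcal{S}:v\in S\}|/|\mathcal{S}|$, the fraction of edges of $\mathcal{S}$ containing $v$ (so $\varepsilon_v^{\mathcal{S}}\cdot|\mathcal{S}|$ is the number of edges of $\mathcal{S}$ containing $v$). -}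

module Defs where

open import Data.Nat using (ℕ)
open import Data.Product using (_×_; ∃-syntax)
open import Data.Sum using (_⊎_)
open import Data.List using (List; filter; length)
open import Data.List.Membership.Propositional using () renaming (_∈_ to _∈ₗ_)
open import Data.Fin using (Fin)
open import Data.Fin.Subset using (Subset; _∈_; _∉_; _⊆_; _∩_; _∪_; Empty; ⁅_⁆; ⊥)
open import Data.Fin.Subset.Properties using (_∈?_; nonempty?)
open import Relation.Nullary using (¬_; ¬?)

-- Vertex set V = Fin n.  An edge is a subset of V; a hypergraph is its edge set,
-- represented as a list of edges (required to be duplicate-free in the statement).
Hypergraph : ℕ → Set
Hypergraph n = List (Subset n)

IntersectionProperty : ∀ {n} → Hypergraph n → Hypergraph n → Set
IntersectionProperty 𝒢 ℋ = ∀ {G H} → G ∈ₗ 𝒢 → H ∈ₗ ℋ → ¬ Empty (G ∩ H)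

record Assignment (n : ℕ) : Set where
  constructor ⟨_,_⟩
  field
    In : Subset n
    Ex : Subset n
open Assignment public

Disjoint : ∀ {n} → Subset n → Subset n → Set
Disjoint A B = Empty (A ∩ B)

IsAssignment : ∀ {n} → Assignment n → Set
IsAssignment σ = Disjoint (In σ) (Ex σ)

Free : ∀ {n} → Assignment n → Fin n → Set
Free σ v = v ∉ In σ × v ∉ Ex σ

_+ₐ_ : ∀ {n} → Assignment n → Assignment n → Assignment n
σ +ₐ τ = ⟨ In σ ∪ In τ , Ex σ ∪ Ex τ ⟩

Covering : ∀ {n} → Hypergraph n → Hypergraph n → Assignment n → Set
Covering 𝒢 ℋ σ = (∃[ H ] (H ∈ₗ ℋ × H ⊆ In σ)) ⊎ (∃[ G ] (G ∈ₗ 𝒢 × G ⊆ Ex σ))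

Sep : ∀ {n} → Hypergraph n → Assignment n → Hypergraph n
Sep 𝒢 σ = filter (λ G → ¬? (nonempty? (G ∩ In σ))) 𝒢

Com : ∀ {n} → Hypergraph n → Assignment n → Hypergraph n
Com ℋ σ = filter (λ H → ¬? (nonempty? (H ∩ Ex σ))) ℋ

-- ε_v^𝒮 · |𝒮| : the number of edges of 𝒮 containing v.
εmul : ∀ {n} → Fin n → Hypergraph n → ℕ
εmul v 𝒮 = length (filter (v ∈?_) 𝒮)

-- An edge avoiding A ∪ {v} is exactly an edge avoiding A that misses v, which gives the two
-- identities.  For the bounds, an edge H avoiding Ex ∪ (G - v) must still meet G by the
-- intersection property, and the only vertex of G left for it is v; so these edges are among
-- the edges of Com(σ) containing v (and symmetrically for Sep).
module Submission where

open import Defs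
open import Data.Nat using (_≤_; _∸_; _+_; suc; z≤n; s≤s)
open import Data.Nat.Properties using (+-suc; m+n∸m≡n; m≤n⇒m≤1+n; module ≤-Reasoning)
open import Data.Product using (_×_; _,_; proj₁)
open import Data.Sum using (inj₁; inj₂)
open import Data.List using (List; []; _∷_; length; filter)
open import Data.List.Properties using (filter-≐)
open import Data.List.Relation.Unary.All as All using (All; []; _∷_)
open import Data.List.Relation.Unary.Unique.Propositional using (Unique)
open import Data.List.Membership.Propositional using () renaming (_∈_ to _∈ₗ_)
open import Data.List.Membership.Propositional.Properties using (∈-filter⁻)
open import Data.Fin.Properties using (_≟_)
open import Data.Fin.Subset using (Subset; _∈_; _∉_; _∩_; _∪_; ⁅_⁆; ⊥; _-_; _⊆_)
open import Data.Fin.Subset.Properties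
  using (_∈?_; nonempty?; x∈p∩q⁺; x∈p∩q⁻; x∈p∪q⁻; x∈⁅x⁆; x∈⁅y⁆⇒x≡y; x∈p∧x≢y⇒x∈p-y; p⊆p∪q; q⊆p∪q)
open import Relation.Binary.PropositionalEquality using (_≡_; refl; cong; sym; trans; subst)
open import Relation.Nullary using (¬_; Dec; yes; no; ¬?; contradiction)
open import Relation.Unary using (Pred; Decidable; _⇒_)
open import Relation.Unary.Properties using (∁?; _∩?_)
open import Function using (_∘_)

module _ {a p q} {A : Set a} {P : Pred A p} {Q : Pred A q} (P? : Decidable P) (Q? : Decidable Q) where

  filter-filter : (xs : List A) → filter Q? (filter P? xs) ≡ filter (P? ∩? Q?) xs
  filter-filter [] = refl
  filter-filter (x ∷ xs) with P? x
  ... | no _ = filter-filter xs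
  ... | yes _ with Q? x
  ...   | yes _ = cong (x ∷_) (filter-filter xs)
  ...   | no _  = filter-filter xs

  length-filter-mono : {xs : List A} → All (P ⇒ Q) xs → length (filter P? xs) ≤ length (filter Q? xs)
  length-filter-mono [] = z≤n
  length-filter-mono {x ∷ _} (P⇒Q ∷ P⇒Qs) with P? x | Q? x
  ... | yes _  | yes _  = s≤s (length-filter-mono P⇒Qs)
  ... | yes Px | no ¬Qx = contradiction (P⇒Q Px) ¬Qx
  ... | no _   | yes _  = m≤n⇒m≤1+n (length-filter-mono P⇒Qs)
  ... | no _   | no _   = length-filter-mono P⇒Qs

module _ {a p} {A : Set a} {P : Pred A p} (P? : Decidable P) where

  length-filter-+-∁ : (xs : List A) → length (filter P? xs) + length (filter (∁? P?) xs) ≡ length xs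
  length-filter-+-∁ [] = refl
  length-filter-+-∁ (x ∷ xs) with P? x
  ... | yes _ = cong suc (length-filter-+-∁ xs)
  ... | no _  = trans (+-suc _ _) (cong suc (length-filter-+-∁ xs))

  length-filter-∁ : (xs : List A) → length (filter (∁? P?) xs) ≡ length xs ∸ length (filter P? xs)
  length-filter-∁ xs = trans (sym (m+n∸m≡n (length (filter P? xs)) _))
                             (cong (_∸ length (filter P? xs)) (length-filter-+-∁ xs))

Disjoint-sym : ∀ {n} {p q : Subset n} → Disjoint p q → Disjoint q p
Disjoint-sym {p = p} {q} p∩q≡∅ (x , x∈q∩p) with x∈p∩q⁻ q p x∈q∩p
... | x∈q , x∈p = p∩q≡∅ (x , x∈p∩q⁺ (x∈p , x∈q))

Disjoint-antitoneʳ : ∀ {n} {p q r : Subset n} → r ⊆ q → Disjoint p q → Disjoint p r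
Disjoint-antitoneʳ {p = p} {r = r} r⊆q p∩q≡∅ (x , x∈p∩r) with x∈p∩q⁻ p r x∈p∩r
... | x∈p , x∈r = p∩q≡∅ (x , x∈p∩q⁺ (x∈p , r⊆q x∈r))

Disjoint-∪⁻ : ∀ {n} {p q r : Subset n} → Disjoint p (q ∪ r) → Disjoint p q × Disjoint p r
Disjoint-∪⁻ {q = q} {r} p∩[q∪r]≡∅ =
  Disjoint-antitoneʳ (p⊆p∪q r) p∩[q∪r]≡∅ , Disjoint-antitoneʳ (q⊆p∪q q r) p∩[q∪r]≡∅

Disjoint-∪⁺ : ∀ {n} {p q r : Subset n} → Disjoint p q → Disjoint p r → Disjoint p (q ∪ r)
Disjoint-∪⁺ {p = p} {q} {r} p∩q≡∅ p∩r≡∅ (x , x∈p∩[q∪r]) with x∈p∩q⁻ p (q ∪ r) x∈p∩[q∪r]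
... | x∈p , x∈q∪r with x∈p∪q⁻ q r x∈q∪r
...   | inj₁ x∈q = p∩q≡∅ (x , x∈p∩q⁺ (x∈p , x∈q))
...   | inj₂ x∈r = p∩r≡∅ (x , x∈p∩q⁺ (x∈p , x∈r))

Disjoint-⁅⁆⁻ : ∀ {n} {p : Subset n} {x} → Disjoint p ⁅ x ⁆ → x ∉ p
Disjoint-⁅⁆⁻ {x = x} p∩⁅x⁆≡∅ x∈p = p∩⁅x⁆≡∅ (x , x∈p∩q⁺ (x∈p , x∈⁅x⁆ x))

Disjoint-⁅⁆⁺ : ∀ {n} {p : Subset n} {x} → x ∉ p → Disjoint p ⁅ x ⁆
Disjoint-⁅⁆⁺ {p = p} {x} x∉p (y , y∈p∩⁅x⁆) with x∈p∩q⁻ p ⁅ x ⁆ y∈p∩⁅x⁆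
... | y∈p , y∈⁅x⁆ = x∉p (subst (_∈ p) (x∈⁅y⁆⇒x≡y x y∈⁅x⁆) y∈p)

p∩q≢∅∧q∩[p-x]≡∅⇒x∈q : ∀ {n} {p q : Subset n} {x} → ¬ Disjoint p q → Disjoint q (p - x) → x ∈ q
p∩q≢∅∧q∩[p-x]≡∅⇒x∈q {p = p} {q} {x} p∩q≢∅ q∩[p-x]≡∅ with x ∈? q
... | yes x∈q = x∈q
... | no x∉q  = contradiction p∩q≡∅ p∩q≢∅
  where
  p∩q≡∅ : Disjoint p q
  p∩q≡∅ (y , y∈p∩q) with x∈p∩q⁻ p q y∈p∩q
  ... | y∈p , y∈q with y ≟ x
  ...   | yes refl = x∉q y∈q
  ...   | no y≢x   = q∩[p-x]≡∅ (y , x∈p∩q⁺ (y∈q , x∈p∧x≢y⇒x∈p-y y∈p y≢x))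

disjoint? : ∀ {n} (p q : Subset n) → Dec (Disjoint p q)
disjoint? p q = ¬? (nonempty? (p ∩ q))

-- Sep 𝒢 σ and Com ℋ σ are definitionally avoiding (In σ) 𝒢 and avoiding (Ex σ) ℋ.
avoiding : ∀ {n} → Subset n → Hypergraph n → Hypergraph n
avoiding A = filter (λ E → disjoint? E A)

∈-avoiding⁻ : ∀ {n} {A : Subset n} {𝒮 E} → E ∈ₗ avoiding A 𝒮 → E ∈ₗ 𝒮
∈-avoiding⁻ {A = A} E∈ = proj₁ (∈-filter⁻ (λ E → disjoint? E A) E∈)

module _ {n} (A : Subset n) (𝒮 : Hypergraph n) where

  avoiding-∪⁅⁆ : ∀ v → avoiding (A ∪ ⁅ v ⁆) 𝒮 ≡ filter (∁? (v ∈?_)) (avoiding A 𝒮)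
  avoiding-∪⁅⁆ v = trans (filter-≐ _ _ (to , from) 𝒮) (sym (filter-filter _ _ 𝒮))
    where
    to : ∀ {E} → Disjoint E (A ∪ ⁅ v ⁆) → Disjoint E A × v ∉ E
    to E∩[A∪⁅v⁆]≡∅ with Disjoint-∪⁻ E∩[A∪⁅v⁆]≡∅
    ... | E∩A≡∅ , E∩⁅v⁆≡∅ = E∩A≡∅ , Disjoint-⁅⁆⁻ E∩⁅v⁆≡∅
    from : ∀ {E} → Disjoint E A × v ∉ E → Disjoint E (A ∪ ⁅ v ⁆)
    from (E∩A≡∅ , v∉E) = Disjoint-∪⁺ E∩A≡∅ (Disjoint-⁅⁆⁺ v∉E)

  length-avoiding-∪⁅⁆ : ∀ v → length (avoiding (A ∪ ⁅ v ⁆) 𝒮) ≡ length (avoiding A 𝒮) ∸ εmul v (avoiding A 𝒮)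
  length-avoiding-∪⁅⁆ v = trans (cong length (avoiding-∪⁅⁆ v)) (length-filter-∁ (v ∈?_) (avoiding A 𝒮))

  length-avoiding-∪-minus-≤ : ∀ {F} v → (∀ {E} → E ∈ₗ 𝒮 → ¬ Disjoint F E) →
                              length (avoiding (A ∪ (F - v)) 𝒮) ≤ εmul v (avoiding A 𝒮)
  length-avoiding-∪-minus-≤ {F} v meets-F = begin
    length (avoiding (A ∪ (F - v)) 𝒮)                    ≤⟨ length-filter-mono _ _ (All.tabulate avoids-A∧∋v) ⟩
    length (filter ((λ E → disjoint? E A) ∩? (v ∈?_)) 𝒮) ≡⟨ cong length (filter-filter _ _ 𝒮) ⟨
    εmul v (avoiding A 𝒮)                                ∎
    where
    open ≤-Reasoning
    avoids-A∧∋v : ∀ {E} → E ∈ₗ 𝒮 → Disjoint E (A ∪ (F - v)) → Disjoint E A × v ∈ E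
    avoids-A∧∋v E∈𝒮 E∩[A∪[F-v]]≡∅ with Disjoint-∪⁻ E∩[A∪[F-v]]≡∅
    ... | E∩A≡∅ , E∩[F-v]≡∅ = E∩A≡∅ , p∩q≢∅∧q∩[p-x]≡∅⇒x∈q (meets-F E∈𝒮) E∩[F-v]≡∅

lemma7 : ∀ {n} (𝒢 ℋ : Hypergraph n) → Unique 𝒢 → Unique ℋ →
    IntersectionProperty 𝒢 ℋ →
    (σ : Assignment n) → IsAssignment σ → ¬ Covering 𝒢 ℋ σ →
    (∀ v → Free σ v →
      (length (Sep 𝒢 (σ +ₐ ⟨ ⁅ v ⁆ , ⊥ ⟩)) ≡ length (Sep 𝒢 σ) ∸ εmul v (Sep 𝒢 σ))
      × (length (Com ℋ (σ +ₐ ⟨ ⊥ , ⁅ v ⁆ ⟩)) ≡ length (Com ℋ σ) ∸ εmul v (Com ℋ σ)))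
    × (∀ G H v w → G ∈ₗ Sep 𝒢 σ → H ∈ₗ Com ℋ σ → v ∈ G → w ∈ H → Free σ v → Free σ w →
      (length (Com ℋ (σ +ₐ ⟨ ⁅ v ⁆ , G - v ⟩)) ≤ εmul v (Com ℋ σ))
      × (length (Sep 𝒢 (σ +ₐ ⟨ H - w , ⁅ w ⁆ ⟩)) ≤ εmul w (Sep 𝒢 σ)))
lemma7 𝒢 ℋ _ _ meets σ _ _ =
    (λ v _ → length-avoiding-∪⁅⁆ (In σ) 𝒢 v , length-avoiding-∪⁅⁆ (Ex σ) ℋ v)
  , λ G H v w G∈Sep H∈Com _ _ _ _ →
        length-avoiding-∪-minus-≤ (Ex σ) ℋ v (meets (∈-avoiding⁻ G∈Sep))
      , length-avoiding-∪-minus-≤ (In σ) 𝒢 w (λ G′∈𝒢 → meets G′∈𝒢 (∈-avoiding⁻ H∈Com) ∘ Disjoint-sym)
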